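{- Let $n \in \mathbb{N}^*$, let $k \geq 2$ be an integer and let $a, b \in \mathbb{F}_{2^n}$ with $a \neq 0$. Then there exist $c, d \in \overline{\mathbb{F}_{2^n}}$ such that for every $x \in \mathbf{P}^1(\mathbb{F}_{2^n})$: $$\theta_{c,d}^{k/2}(x) = \theta_{a,b,k}(x) \ \text{ if } k \text{ is even}, \qquad \theta_{c,d}^{k}(x) = \theta_{a,b,k}^2(x) \ \text{ if } k \text{ is odd}.$$
   Context: $\overline{\mathbb{F}_{2^n}}$ is an algebraic closure of $\mathbb{F}_{2^n}$, and $\mathbf{P}^1(F) = F \cup \{\infty\}$. $\theta_{a,b,k}(x) = a x^{2^k} + b$ for $x \in \mathbb{F}_{2^n}$ and $\theta_{a,b,k}(\infty) = \infty$. For $c, d \in \overline{\mathbb{F}_{2^n}}$, $\theta_{c,d}$ is the map on $\mathbf{P}^1(\overline{\mathbb{F}_{2^n}})$ with $\theta_{c,d}(x) = c x^4 + d$ for $x \in \overline{\mathbb{F}_{2^n}}$ and $\theta_{c,d}(\infty) = \infty$. Powers denote iterated composition. -}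

module Defs where

open import Level using (Level; _⊔_)
open import Data.Nat using (ℕ; zero; suc; _≥_; _≤_) renaming (_^_ to _^ℕ_)
open import Data.Fin using (Fin)
open import Data.List using (List; []; _∷_; map; length; _++_; [_])
open import Data.List.Relation.Unary.Any using (Any)
open import Data.Maybe using (Maybe; just; nothing)
open import Data.Product using (Σ; ∃; _×_; _,_)
open import Data.Unit.Polymorphic using (⊤)
open import Data.Empty.Polymorphic using (⊥)
open import Relation.Nullary using (¬_)
open import Relation.Binary.PropositionalEquality using (_≡_)
open import Algebra.Bundles using (CommutativeRing)
open import Algebra.Morphism.Structures using (module RingMorphisms)

iter : ∀ {a} {A : Set a} → (A → A) → ℕ → A → A
iter f zero    x = x
iter f (suc m) x = f (iter f m x)

module _ {c ℓ : Level} (R : CommutativeRing c ℓ) where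
  open CommutativeRing R

  pow : Carrier → ℕ → Carrier
  pow x zero    = 1#
  pow x (suc m) = x * pow x m

  -- evaluation of the polynomial with coefficient list (a₀ ∷ a₁ ∷ …) at x (Horner)
  evalPoly : List Carrier → Carrier → Carrier
  evalPoly []       x = 0#
  evalPoly (a ∷ as) x = a + x * evalPoly as x

  IsField : Set (c ⊔ ℓ)
  IsField = (¬ (1# ≈ 0#)) × (∀ x → ¬ (x ≈ 0#) → ∃ λ y → (x * y) ≈ 1#)

  HasCardinality : ℕ → Set (c ⊔ ℓ)
  HasCardinality m = Σ (Fin m → Carrier) λ e →
    (∀ i j → e i ≈ e j → i ≡ j) ×
    (∀ x → ∃ λ i → e i ≈ x)

  -- Every monic polynomial of degree ≥ 1 has a root:
  -- the polynomial with coefficients cs ++ [ 1 ] (so degree = length cs ≥ 1).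
  IsAlgebraicallyClosed : Set (c ⊔ ℓ)
  IsAlgebraicallyClosed = ∀ (cs : List Carrier) → length cs ≥ 1 →
    ∃ λ x → evalPoly (cs ++ [ 1# ]) x ≈ 0#

  -- Projective line P¹(R) = R ∪ {∞}, with ∞ represented by nothing.
  P1 : Set c
  P1 = Maybe Carrier

  _≈P_ : P1 → P1 → Set ℓ
  just x  ≈P just y  = x ≈ y
  nothing ≈P nothing = ⊤
  _       ≈P _       = ⊥

  θ : Carrier → Carrier → ℕ → P1 → P1
  θ a b k (just x) = just (a * pow x (2 ^ℕ k) + b)
  θ a b k nothing  = nothing

  θ₄ : Carrier → Carrier → P1 → P1
  θ₄ c d (just x) = just (c * pow x 4 + d)
  θ₄ c d nothing  = nothing

record IsAlgebraicClosure {c₁ ℓ₁ c₂ ℓ₂ : Level}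
    (F : CommutativeRing c₁ ℓ₁) (K : CommutativeRing c₂ ℓ₂)
    (ι : CommutativeRing.Carrier F → CommutativeRing.Carrier K) : Set (c₁ ⊔ ℓ₁ ⊔ c₂ ⊔ ℓ₂) where
  module F = CommutativeRing F
  module K = CommutativeRing K
  open RingMorphisms F.rawRing K.rawRing using (IsRingHomomorphism)
  field
    isField     : IsField K
    ι-hom       : IsRingHomomorphism ι
    algClosed   : IsAlgebraicallyClosed K
    algebraic   : ∀ (y : K.Carrier) → ∃ λ (cs : List F.Carrier) →
                    Any (λ a → ¬ (a F.≈ F.0#)) cs × (evalPoly K (map ι cs) y K.≈ K.0#)

liftP1 : ∀ {a b} {A : Set a} {B : Set b} → (A → B) → Maybe A → Maybe B
liftP1 f (just x) = just (f x)
liftP1 f nothing  = nothing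

module Submission where

-- Write affPow a b q for the map x ↦ a·x^q + b, so that θ_{a,b,k} acts on
-- finite points as affPow a b (2^k) and θ_{c,d} as affPow c d 4.
--  * A field with 2^n elements has characteristic 2: otherwise x ↦ -x is an involution
--    with the single fixed point 0, and counting orbits makes the cardinality odd
--    (module Involution, then EvenCardinality).  Hence the closure K has characteristic 2.
--  * In characteristic 2 every power of 2 is an additive exponent (Frobenius), and for an
--    additive exponent q, affine power maps compose: affPow a b q ∘ affPow a′ b′ q′ is again
--    an affine power map with exponent q′·q.  So the j-th iterate of affPow c d 4 is
--    affPow (leading j) (constant j) (4^j) (module RingFacts.Iterate).
--  * In the algebraically closed field K, given A ≠ 0 and B, we choose c with leading j = A
--    (a root of c^(1+4+⋯+4^(j-1)) = A), a fixed point e of affPow A B (4^j), and d = e + c·e⁴;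
--    then e is fixed by affPow c d 4 as well, which forces constant j = B
--    (RingFacts.Char2.prescribe-iterate).
--  * For even k = 2j apply this with A = a, B = b; for odd k note that θ_{a,b,k}² is itself
--    an affine power map with exponent 2^k·2^k = 4^k and apply it with j = k (Construction).
--    The point ∞ is fixed by all maps involved.

open import Defs
open import Level using (Level; _⊔_)
open import Data.Nat using (ℕ; zero; suc; _≤_; _≥_; _%_; _/_; s≤s; z≤n)
  renaming (_^_ to _^ℕ_; _*_ to _*ℕ_)
import Data.Nat.Properties as ℕₚ
open import Data.Fin using (Fin)
open import Data.Maybe using (just; nothing)
open import Data.Product using (∃; _×_; _,_; proj₁; proj₂)
open import Data.Empty using (⊥-elim)
open import Relation.Nullary using (¬_; Dec; yes; no)
import Relation.Binary.PropositionalEquality as P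
open P using (_≡_)
open import Algebra.Bundles using (CommutativeRing)
open import Algebra.Morphism.Structures using (module RingMorphisms)

module Involution where
  open import Data.Nat using (_+_; _*_)
  open import Data.Nat.Divisibility using (_∣_; m∣m*n; ∣m+n∣m⇒∣n; ∣1⇒≡1)
  open import Data.Bool using (if_then_else_)
  open import Data.Fin using (punchIn)
  open import Data.Fin.Properties using (_≟_; _<?_; <-cmp; punchInᵢ≢i)
  open import Data.Fin.Permutation using (permutation)
  open import Relation.Nullary using (does)
  open import Relation.Nullary.Decidable using (dec-true; dec-false)
  open import Relation.Binary.Definitions using (tri<; tri≈; tri>)
  open P using (_≢_; refl; sym; trans; cong; cong₂; module ≡-Reasoning)
  open import Algebra.Properties.CommutativeMonoid.Sum ℕₚ.+-0-commutativeMonoid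
    using (sum; sum-cong-≗; sum-remove; ∑-distrib-+; sum-permute)

  ⟦_⟧ : ∀ {p} {P : Set p} → Dec P → ℕ
  ⟦ P? ⟧ = if does P? then 1 else 0

  ⟦yes⟧ : ∀ {p} {P : Set p} (P? : Dec P) → P → ⟦ P? ⟧ ≡ 1
  ⟦yes⟧ P? p rewrite dec-true P? p = refl

  ⟦no⟧ : ∀ {p} {P : Set p} (P? : Dec P) → ¬ P → ⟦ P? ⟧ ≡ 0
  ⟦no⟧ P? ¬p rewrite dec-false P? ¬p = refl

  trichotomy-count : ∀ {N} (i j : Fin N) → ⟦ i <? j ⟧ + ⟦ j <? i ⟧ + ⟦ i ≟ j ⟧ ≡ 1
  trichotomy-count i j with <-cmp i j
  ... | tri< i<j i≢j j≮i rewrite ⟦yes⟧ (i <? j) i<j | ⟦no⟧ (j <? i) j≮i | ⟦no⟧ (i ≟ j) i≢j = refl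
  ... | tri≈ i≮j i≡j j≮i rewrite ⟦no⟧ (i <? j) i≮j | ⟦no⟧ (j <? i) j≮i | ⟦yes⟧ (i ≟ j) i≡j = refl
  ... | tri> i≮j i≢j j<i rewrite ⟦no⟧ (i <? j) i≮j | ⟦yes⟧ (j <? i) j<i | ⟦no⟧ (i ≟ j) i≢j = refl

  sum-ones : ∀ N → sum {N} (λ _ → 1) ≡ N
  sum-ones zero    = refl
  sum-ones (suc N) = cong suc (sum-ones N)

  sum-zeros : ∀ N → sum {N} (λ _ → 0) ≡ 0
  sum-zeros zero    = refl
  sum-zeros (suc N) = sum-zeros N

  sum-point : ∀ {N} (z : Fin N) → sum (λ i → ⟦ i ≟ z ⟧) ≡ 1
  sum-point {suc N} z = begin
    sum (λ i → ⟦ i ≟ z ⟧)                                        ≡⟨ sum-remove {i = z} (λ i → ⟦ i ≟ z ⟧) ⟩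
    ⟦ z ≟ z ⟧ + sum (λ i → ⟦ punchIn z i ≟ z ⟧)                  ≡⟨ cong₂ _+_ (⟦yes⟧ (z ≟ z) refl)
                                                                      (sum-cong-≗ (λ i → ⟦no⟧ (punchIn z i ≟ z) (punchInᵢ≢i z i))) ⟩
    1 + sum {N} (λ _ → 0)                                        ≡⟨ cong suc (sum-zeros N) ⟩
    1                                                            ∎
    where open ≡-Reasoning

  -- An involution of a finite set with exactly one fixed point z: the remaining
  -- points split into pairs {i, σ i}, counted once each by the points with i < σ i.
  involution-odd : ∀ {N} (σ : Fin N → Fin N) → (∀ i → σ (σ i) ≡ i) →
                   (z : Fin N) → (∀ i → i ≡ σ i → i ≡ z) → σ z ≡ z →
                   ∃ λ h → N ≡ 2 * h + 1
  involution-odd {N} σ σσ z fixed⇒z σz≡z = h , (begin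
    N                                        ≡⟨ sum-ones N ⟨
    sum {N} (λ _ → 1)                        ≡⟨ sum-cong-≗ (λ i → trichotomy-count i (σ i)) ⟨
    sum (λ i → below i + above i + fixed i)  ≡⟨ ∑-distrib-+ (λ i → below i + above i) fixed ⟩
    sum (λ i → below i + above i) + sum fixed
      ≡⟨ cong₂ _+_ (∑-distrib-+ below above) (trans (sum-cong-≗ fixed≗point) (sum-point z)) ⟩
    h + sum above + 1                        ≡⟨ cong (λ m → h + m + 1) above≡below ⟩
    h + h + 1                                ≡⟨ cong (λ m → h + m + 1) (ℕₚ.+-identityʳ h) ⟨
    2 * h + 1                                ∎)
    where
    open ≡-Reasoning
    below above fixed : Fin N → ℕ
    below i = ⟦ i <? σ i ⟧
    above i = ⟦ σ i <? i ⟧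
    fixed i = ⟦ i ≟ σ i ⟧
    h : ℕ
    h = sum below
    -- Reindexing by the permutation σ exchanges the two kinds of pairs.
    above≡below : sum above ≡ h
    above≡below = trans (sum-permute above (permutation σ σ σσ σσ))
                        (sum-cong-≗ (λ i → cong (λ j → ⟦ j <? σ i ⟧) (σσ i)))
    fixed≗point : ∀ i → fixed i ≡ ⟦ i ≟ z ⟧
    fixed≗point i with i ≟ σ i | i ≟ z
    ... | yes i≡σi | yes _   = refl
    ... | yes i≡σi | no i≢z  = ⊥-elim (i≢z (fixed⇒z i i≡σi))
    ... | no i≢σi  | yes i≡z = ⊥-elim (i≢σi (trans i≡z (sym (trans (cong σ i≡z) σz≡z))))
    ... | no _     | no _    = refl

  even≢odd : ∀ {N} h → 2 ∣ N → N ≢ 2 * h + 1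
  even≢odd h 2∣N refl with ∣1⇒≡1 (∣m+n∣m⇒∣n 2∣N (m∣m*n h))
  ... | ()

module RingFacts {c ℓ : Level} (R : CommutativeRing c ℓ) where
  open CommutativeRing R
  open import Data.List using (_∷_; _++_; [_]; replicate)
  open import Algebra.Properties.CommutativeSemiring.Exp commutativeSemiring public
    using (_^_; ^-congˡ; ^-assocʳ; ^-distrib-*)
  open import Algebra.Properties.Group +-group
    using (∙-cancelˡ; inverseʳ-unique; ⁻¹-involutive; x∙y⁻¹≈ε⇒x≈y)
  open import Algebra.Solver.Ring.NaturalCoefficients.Default commutativeSemiring
    using (solve; _:+_; _:*_; _:^_; _:=_)
  open import Relation.Binary.Reasoning.Setoid setoid

  -- The power function of Defs agrees with the standard library's exponentiation,
  -- so all power laws can be taken from Algebra.Properties.Semiring.Exp.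
  pow≡^ : ∀ x n → pow R x n P.≡ x ^ n
  pow≡^ x zero    = P.refl
  pow≡^ x (suc n) = P.cong (x *_) (pow≡^ x n)

  iter-fixed : ∀ {f : Carrier → Carrier} → (∀ {x y} → x ≈ y → f x ≈ f y) →
               ∀ {e} → f e ≈ e → ∀ j → iter f j e ≈ e
  iter-fixed f-cong fe≈e zero    = refl
  iter-fixed f-cong fe≈e (suc j) = trans (f-cong (iter-fixed f-cong fe≈e j)) fe≈e

  affPow : Carrier → Carrier → ℕ → Carrier → Carrier
  affPow a b q x = a * x ^ q + b

  affPow-cong : ∀ {a a′ b b′} q {x x′} → a ≈ a′ → b ≈ b′ → x ≈ x′ →
                affPow a b q x ≈ affPow a′ b′ q x′
  affPow-cong q a≈a′ b≈b′ x≈x′ = +-cong (*-cong a≈a′ (^-congˡ q x≈x′)) b≈b′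

  Additive : ℕ → Set (c ⊔ ℓ)
  Additive q = ∀ x y → (x + y) ^ q ≈ x ^ q + y ^ q

  additive-1 : Additive 1
  additive-1 x y = begin
    (x + y) * 1#     ≈⟨ *-identityʳ (x + y) ⟩
    x + y            ≈⟨ +-cong (*-identityʳ x) (*-identityʳ y) ⟨
    x * 1# + y * 1#  ∎

  additive-* : ∀ {p q} → Additive p → Additive q → Additive (p *ℕ q)
  additive-* {p} {q} addP addQ x y = begin
    (x + y) ^ (p *ℕ q)           ≈⟨ ^-assocʳ (x + y) p q ⟨
    ((x + y) ^ p) ^ q            ≈⟨ ^-congˡ q (addP x y) ⟩
    (x ^ p + y ^ p) ^ q          ≈⟨ addQ (x ^ p) (y ^ p) ⟩
    (x ^ p) ^ q + (y ^ p) ^ q    ≈⟨ +-cong (^-assocʳ x p q) (^-assocʳ y p q) ⟩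
    x ^ (p *ℕ q) + y ^ (p *ℕ q)  ∎

  affPow-∘ : ∀ {q} → Additive q → ∀ a b a′ b′ q′ x →
             affPow a b q (affPow a′ b′ q′ x) ≈ affPow (a * a′ ^ q) (a * b′ ^ q + b) (q′ *ℕ q) x
  affPow-∘ {q} add a b a′ b′ q′ x = begin
    a * (a′ * x ^ q′ + b′) ^ q + b             ≈⟨ +-congʳ (*-congˡ (add (a′ * x ^ q′) b′)) ⟩
    a * ((a′ * x ^ q′) ^ q + b′ ^ q) + b       ≈⟨ +-congʳ (*-congˡ (+-congʳ (^-distrib-* a′ (x ^ q′) q))) ⟩
    a * (a′ ^ q * (x ^ q′) ^ q + b′ ^ q) + b   ≈⟨ +-congʳ (*-congˡ (+-congʳ (*-congˡ (^-assocʳ x q′ q)))) ⟩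
    a * (a′ ^ q * x ^ (q′ *ℕ q) + b′ ^ q) + b  ≈⟨ regroup a (a′ ^ q) (x ^ (q′ *ℕ q)) (b′ ^ q) b ⟩
    a * a′ ^ q * x ^ (q′ *ℕ q) + (a * b′ ^ q + b) ∎
    where
    regroup : ∀ a a′ X b′ b → a * (a′ * X + b′) + b ≈ a * a′ * X + (a * b′ + b)
    regroup = solve 5 (λ a a′ X b′ b → a :* (a′ :* X :+ b′) :+ b := a :* a′ :* X :+ (a :* b′ :+ b)) refl

  -- 1 + q + ⋯ + q^(j-1): the exponent of c in the leading coefficient of the j-th iterate.
  geometric : ℕ → ℕ → ℕ
  geometric q zero    = 0
  geometric q (suc j) = suc (geometric q j *ℕ q)

  module Iterate {q} (add : Additive q) (c d : Carrier) where
    leading constant : ℕ → Carrier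
    leading zero     = 1#
    leading (suc j)  = c * leading j ^ q
    constant zero    = 0#
    constant (suc j) = c * constant j ^ q + d

    iterate : ∀ j x → iter (affPow c d q) j x ≈ affPow (leading j) (constant j) (q ^ℕ j) x
    iterate zero x = begin
      x                 ≈⟨ *-identityʳ x ⟨
      x * 1#            ≈⟨ *-identityˡ (x * 1#) ⟨
      1# * (x * 1#)     ≈⟨ +-identityʳ _ ⟨
      1# * (x * 1#) + 0# ∎
    iterate (suc j) x = begin
      affPow c d q (iter (affPow c d q) j x)
        ≈⟨ affPow-cong q refl refl (iterate j x) ⟩
      affPow c d q (affPow (leading j) (constant j) (q ^ℕ j) x)
        ≈⟨ affPow-∘ add c d (leading j) (constant j) (q ^ℕ j) x ⟩
      affPow (leading (suc j)) (constant (suc j)) (q ^ℕ j *ℕ q) x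
        ≡⟨ P.cong (λ m → affPow (leading (suc j)) (constant (suc j)) m x) (ℕₚ.*-comm (q ^ℕ j) q) ⟩
      affPow (leading (suc j)) (constant (suc j)) (q ^ℕ suc j) x ∎

    leading-pow : ∀ j → leading j ≈ c ^ geometric q j
    leading-pow zero    = refl
    leading-pow (suc j) = *-congˡ (trans (^-congˡ q (leading-pow j)) (^-assocʳ c (geometric q j) q))

    constant-at-fixed : ∀ {e} → affPow c d q e ≈ e → ∀ j →
                        leading j * e ^ (q ^ℕ j) + constant j ≈ e
    constant-at-fixed {e} fixed j =
      trans (sym (iterate j e)) (iter-fixed (affPow-cong q refl refl) fixed j)

  2≤q^suc : ∀ {q} j → 2 ≤ q → 2 ≤ q ^ℕ suc j
  2≤q^suc {suc q′} j 2≤q = ℕₚ.*-mono-≤ 2≤q (ℕₚ.m^n>0 (suc q′) j)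

  evalPoly-monomial : ∀ r y → evalPoly R (replicate r 0# ++ [ 1# ]) y ≈ y ^ r
  evalPoly-monomial zero    y = trans (+-congˡ (zeroʳ y)) (+-identityʳ 1#)
  evalPoly-monomial (suc r) y = trans (+-identityˡ _) (*-congˡ (evalPoly-monomial r y))

  nth-root : IsAlgebraicallyClosed R → ∀ r A → ∃ λ y → y ^ suc r ≈ A
  nth-root closed r A with closed (- A ∷ replicate r 0#) (s≤s z≤n)
  ... | y , root = y , (begin
    y * y ^ r                                       ≈⟨ *-congˡ (evalPoly-monomial r y) ⟨
    y * evalPoly R (replicate r 0# ++ [ 1# ]) y     ≈⟨ inverseʳ-unique (- A) _ root ⟩
    - - A                                           ≈⟨ ⁻¹-involutive A ⟩
    A                                               ∎)

  two-times : ∀ x → (1# + 1#) * x ≈ x + x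
  two-times x = trans (distribʳ x 1# 1#) (+-cong (*-identityˡ x) (*-identityˡ x))

  module Field (isField : IsField R) where
    cancel-nonzero : ∀ {x y} → ¬ (x ≈ 0#) → x * y ≈ 0# → y ≈ 0#
    cancel-nonzero {x} {y} x≉0 xy≈0 with proj₂ isField x x≉0
    ... | w , xw≈1 = begin
      y             ≈⟨ *-identityˡ y ⟨
      1# * y        ≈⟨ *-congʳ xw≈1 ⟨
      (x * w) * y   ≈⟨ *-congʳ (*-comm x w) ⟩
      (w * x) * y   ≈⟨ *-assoc w x y ⟩
      w * (x * y)   ≈⟨ *-congˡ xy≈0 ⟩
      w * 0#        ≈⟨ zeroʳ w ⟩
      0#            ∎

    ^-nonzero : ∀ {x} n → ¬ (x ≈ 0#) → ¬ (x ^ n ≈ 0#)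
    ^-nonzero zero    x≉0 1≈0    = proj₁ isField 1≈0
    ^-nonzero (suc n) x≉0 xxⁿ≈0 = ^-nonzero n x≉0 (cancel-nonzero x≉0 xxⁿ≈0)

  module Char2 (char2 : 1# + 1# ≈ 0#) where
    double≈0 : ∀ x → x + x ≈ 0#
    double≈0 x = begin
      x + x              ≈⟨ two-times x ⟨
      (1# + 1#) * x      ≈⟨ *-congʳ char2 ⟩
      0# * x             ≈⟨ zeroˡ x ⟩
      0#                 ∎

    sum≈0⇒≈ : ∀ {x y} → x + y ≈ 0# → x ≈ y
    sum≈0⇒≈ {x} {y} x+y≈0 = x∙y⁻¹≈ε⇒x≈y x y (trans (+-congˡ -y≈y) x+y≈0)
      where
      -y≈y : - y ≈ y
      -y≈y = sym (inverseʳ-unique y y (double≈0 y))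

    additive-2 : Additive 2
    additive-2 x y = begin
      (x + y) ^ 2                          ≈⟨ square-expand x y ⟩
      x ^ 2 + y ^ 2 + (x * y + x * y)      ≈⟨ +-congˡ (double≈0 (x * y)) ⟩
      x ^ 2 + y ^ 2 + 0#                   ≈⟨ +-identityʳ _ ⟩
      x ^ 2 + y ^ 2                        ∎
      where
      square-expand : ∀ x y → (x + y) ^ 2 ≈ x ^ 2 + y ^ 2 + (x * y + x * y)
      square-expand = solve 2 (λ x y → (x :+ y) :^ 2 := x :^ 2 :+ y :^ 2 :+ (x :* y :+ x :* y)) refl

    frobenius : ∀ k → Additive (2 ^ℕ k)
    frobenius zero    = additive-1
    frobenius (suc k) = additive-* {2} {2 ^ℕ k} additive-2 (frobenius k)

    module _ (isField : IsField R) (closed : IsAlgebraicallyClosed R) where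
      -- For A ≠ 0 and Q ≥ 2 the map y ↦ A·y^Q + B has a fixed point: it is a root of the
      -- monic polynomial y^Q + w·y + w·B, where w = A⁻¹.
      affPow-fixed-point : ∀ {Q} → 2 ≤ Q → ∀ A B → ¬ (A ≈ 0#) → ∃ λ e → affPow A B Q e ≈ e
      affPow-fixed-point {suc (suc r)} (s≤s (s≤s z≤n)) A B A≉0 with proj₂ isField A A≉0
      ... | w , Aw≈1 with closed (w * B ∷ w ∷ replicate r 0#) (s≤s z≤n)
      ... | e , root = e , sum≈0⇒≈ (begin
        A * (e * (e * e ^ r)) + B + e              ≈⟨ +-cong (+-cong (*-congˡ (*-congˡ (*-congˡ (evalPoly-monomial r e)))) (scale B)) (scale e) ⟨
        A * (e * (e * M)) + A * w * B + A * w * e  ≈⟨ expand A w B e M ⟩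
        A * (w * B + e * (w + e * M))              ≈⟨ *-congˡ root ⟩
        A * 0#                                     ≈⟨ zeroʳ A ⟩
        0#                                         ∎)
        where
        M : Carrier
        M = evalPoly R (replicate r 0# ++ [ 1# ]) e
        scale : ∀ x → A * w * x ≈ x
        scale x = trans (*-congʳ Aw≈1) (*-identityˡ x)
        expand : ∀ A w B e M → A * (e * (e * M)) + A * w * B + A * w * e ≈ A * (w * B + e * (w + e * M))
        expand = solve 5 (λ A w B e M → A :* (e :* (e :* M)) :+ A :* w :* B :+ A :* w :* e
                                         := A :* (w :* B :+ e :* (w :+ e :* M))) refl

      -- Choose c with
      -- c^(1+q+⋯+q^j) = A, a fixed point e of x ↦ A·x^(q^(j+1)) + B, and d = e + c·e^q,
      -- so that e is also fixed by x ↦ c·x^q + d; the constant terms then agree at e.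
      prescribe-iterate : ∀ {q} → Additive q → 2 ≤ q → ∀ j A B → ¬ (A ≈ 0#) →
        ∃ λ c → ∃ λ d → ∀ x → iter (affPow c d q) (suc j) x ≈ affPow A B (q ^ℕ suc j) x
      prescribe-iterate {q} add 2≤q j A B A≉0
        with nth-root closed (geometric q j *ℕ q) A
           | affPow-fixed-point (2≤q^suc j 2≤q) A B A≉0
      ... | c , cᴺ≈A | e , e-fixed = c , d , λ x →
        trans (iterate (suc j) x) (affPow-cong (q ^ℕ suc j) leading≈A constant≈B refl)
        where
        d : Carrier
        d = e + c * e ^ q
        open Iterate {q} add c d
        fixed : affPow c d q e ≈ e
        fixed = begin
          c * e ^ q + (e + c * e ^ q)    ≈⟨ +-congˡ (+-comm e _) ⟩
          c * e ^ q + (c * e ^ q + e)    ≈⟨ +-assoc _ _ e ⟨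
          c * e ^ q + c * e ^ q + e      ≈⟨ +-congʳ (double≈0 _) ⟩
          0# + e                         ≈⟨ +-identityˡ e ⟩
          e                              ∎
        leading≈A : leading (suc j) ≈ A
        leading≈A = trans (leading-pow (suc j)) cᴺ≈A
        constant≈B : constant (suc j) ≈ B
        constant≈B = ∙-cancelˡ (A * e ^ (q ^ℕ suc j)) _ _ (begin
          A * e ^ (q ^ℕ suc j) + constant (suc j)
            ≈⟨ +-congʳ (*-congʳ leading≈A) ⟨
          leading (suc j) * e ^ (q ^ℕ suc j) + constant (suc j)
            ≈⟨ constant-at-fixed fixed (suc j) ⟩
          e
            ≈⟨ e-fixed ⟨
          A * e ^ (q ^ℕ suc j) + B ∎)

module EvenCardinality {c ℓ : Level} (F : CommutativeRing c ℓ) (isField : IsField F) where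
  open CommutativeRing F
  open RingFacts F using (two-times; module Field)
  open Field isField using (cancel-nonzero)
  open import Data.Nat using () renaming (_+_ to _+ℕ_)
  open import Data.Nat.Divisibility using (_∣_)
  open import Data.Fin.Properties using (_≟_)
  open import Algebra.Properties.Group +-group using (ε⁻¹≈ε; ⁻¹-involutive)
  open Involution using (involution-odd; even≢odd)

  ≈-decidable : ∀ {N} → HasCardinality F N → ∀ x y → Dec (x ≈ y)
  ≈-decidable (e , inj , surj) x y with surj x | surj y
  ... | i , eᵢ≈x | j , eⱼ≈y with i ≟ j
  ... | yes P.refl = yes (trans (sym eᵢ≈x) eⱼ≈y)
  ... | no i≢j     = no (λ x≈y → i≢j (inj i j (trans eᵢ≈x (trans x≈y (sym eⱼ≈y)))))

  -- If 1 + 1 ≠ 0 then x ↦ -x is an involution whose only fixed point is 0,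
  -- so a finite field of characteristic ≠ 2 has an odd number of elements.
  odd-cardinality : ∀ {N} → HasCardinality F N → ¬ (1# + 1# ≈ 0#) → ∃ λ h → N ≡ 2 *ℕ h +ℕ 1
  odd-cardinality {N} (e , inj , surj) 2≉0 = involution-odd σ σσ z fixed⇒z σz≡z
    where
    index : Carrier → Fin N
    index x = proj₁ (surj x)
    e∘index : ∀ x → e (index x) ≈ x
    e∘index x = proj₂ (surj x)
    σ : Fin N → Fin N
    σ i = index (- e i)
    σσ : ∀ i → σ (σ i) ≡ i
    σσ i = inj _ _ (trans (e∘index _) (trans (-‿cong (e∘index _)) (⁻¹-involutive (e i))))
    z : Fin N
    z = index 0#
    fixed⇒z : ∀ i → i ≡ σ i → i ≡ z
    fixed⇒z i i≡σi = inj i z (trans (cancel-nonzero 2≉0 2eᵢ≈0) (sym (e∘index 0#)))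
      where
      2eᵢ≈0 : (1# + 1#) * e i ≈ 0#
      2eᵢ≈0 = trans (two-times (e i))
        (trans (+-congˡ (trans (P.subst (λ j → e i ≈ e j) i≡σi refl) (e∘index _))) (-‿inverseʳ (e i)))
    σz≡z : σ z ≡ z
    σz≡z = inj _ _ (trans (e∘index _) (trans (-‿cong (e∘index 0#)) (trans ε⁻¹≈ε (sym (e∘index 0#)))))

  even⇒char2 : ∀ {N} → HasCardinality F N → 2 ∣ N → 1# + 1# ≈ 0#
  even⇒char2 card 2∣N with ≈-decidable card (1# + 1#) 0#
  ... | yes 2≈0 = 2≈0
  ... | no 2≉0 with odd-cardinality card 2≉0
  ...   | h , N≡2h+1 = ⊥-elim (even≢odd h 2∣N N≡2h+1)

module Homomorphism {c₁ ℓ₁ c₂ ℓ₂ : Level} (F : CommutativeRing c₁ ℓ₁) (K : CommutativeRing c₂ ℓ₂)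
  (ι : CommutativeRing.Carrier F → CommutativeRing.Carrier K)
  (hom : RingMorphisms.IsRingHomomorphism (CommutativeRing.rawRing F) (CommutativeRing.rawRing K) ι)
  where
  private
    module F = CommutativeRing F
    module K = CommutativeRing K
    module FF = RingFacts F
    module KF = RingFacts K
  open RingMorphisms.IsRingHomomorphism hom

  ι-^ : ∀ x n → ι (x FF.^ n) K.≈ ι x KF.^ n
  ι-^ x zero    = 1#-homo
  ι-^ x (suc n) = K.trans (*-homo x _) (K.*-congˡ (ι-^ x n))

  ι-affPow : ∀ a b q x → ι (FF.affPow a b q x) K.≈ KF.affPow (ι a) (ι b) q (ι x)
  ι-affPow a b q x = K.trans (+-homo _ b) (K.+-congʳ (K.trans (*-homo a _) (K.*-congˡ (ι-^ x q))))

  ι-nonzero : IsField F → ¬ (K.1# K.≈ K.0#) → ∀ {a} → ¬ (a F.≈ F.0#) → ¬ (ι a K.≈ K.0#)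
  ι-nonzero isField 1≉0 {a} a≉0 ιa≈0 with proj₂ isField a a≉0
  ... | w , aw≈1 = 1≉0 (begin
    K.1#           ≈⟨ 1#-homo ⟨
    ι F.1#         ≈⟨ ⟦⟧-cong aw≈1 ⟨
    ι (a F.* w)    ≈⟨ *-homo a w ⟩
    ι a K.* ι w    ≈⟨ K.*-congʳ ιa≈0 ⟩
    K.0# K.* ι w   ≈⟨ K.zeroˡ (ι w) ⟩
    K.0#           ∎)
    where open import Relation.Binary.Reasoning.Setoid K.setoid

  ι-char2 : F.1# F.+ F.1# F.≈ F.0# → K.1# K.+ K.1# K.≈ K.0#
  ι-char2 char2 = K.trans (K.sym (K.+-cong 1#-homo 1#-homo))
                    (K.trans (K.sym (+-homo F.1# F.1#)) (K.trans (⟦⟧-cong char2) 0#-homo))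

module Exponents where
  open import Data.Nat using (_+_; _*_; _^_)
  open import Data.Nat.Divisibility using (_∣_; m∣m*n)
  open P using (refl; trans; cong; subst; module ≡-Reasoning)
  open ≡-Reasoning

  2∣2^n : ∀ {n} → n ≥ 1 → 2 ∣ 2 ^ n
  2∣2^n {suc n} _ = m∣m*n (2 ^ n)

  even-exponent : ∀ k → 2 ≤ k → k % 2 ≡ 0 → ∃ λ j → (k / 2 ≡ suc j) × (2 ^ k ≡ 4 ^ suc j)
  even-exponent k 2≤k k%2≡0 = from-half (k / 2) refl
    where
    k≡half*2 : k ≡ k / 2 * 2
    k≡half*2 = trans (m≡m%n+[m/n]*n k 2) (cong (_+ k / 2 * 2) k%2≡0)
      where open import Data.Nat.DivMod using (m≡m%n+[m/n]*n)
    from-half : ∀ h → k / 2 ≡ h → ∃ λ j → (k / 2 ≡ suc j) × (2 ^ k ≡ 4 ^ suc j)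
    from-half zero    half≡0 with subst (2 ≤_) (trans k≡half*2 (cong (_* 2) half≡0)) 2≤k
    ... | ()
    from-half (suc j) half≡j+1 = j , half≡j+1 , (begin
      2 ^ k              ≡⟨ cong (2 ^_) (trans k≡half*2 (cong (_* 2) half≡j+1)) ⟩
      2 ^ (suc j * 2)    ≡⟨ cong (2 ^_) (ℕₚ.*-comm (suc j) 2) ⟩
      2 ^ (2 * suc j)    ≡⟨ ℕₚ.^-*-assoc 2 2 (suc j) ⟨
      4 ^ suc j          ∎)

  2^k*2^k≡4^k : ∀ k → 2 ^ k * 2 ^ k ≡ 4 ^ k
  2^k*2^k≡4^k k = begin
    2 ^ k * 2 ^ k    ≡⟨ ℕₚ.^-distribˡ-+-* 2 k k ⟨
    2 ^ (k + k)      ≡⟨ cong (λ m → 2 ^ (k + m)) (ℕₚ.+-identityʳ k) ⟨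
    2 ^ (2 * k)      ≡⟨ ℕₚ.^-*-assoc 2 2 k ⟨
    4 ^ k            ∎

module Construction {c₁ ℓ₁ c₂ ℓ₂ : Level} (F : CommutativeRing c₁ ℓ₁) (K : CommutativeRing c₂ ℓ₂)
  (ι : CommutativeRing.Carrier F → CommutativeRing.Carrier K) (closure : IsAlgebraicClosure F K ι)
  (isFieldF : IsField F)
  (char2 : CommutativeRing._≈_ F (CommutativeRing._+_ F (CommutativeRing.1# F) (CommutativeRing.1# F))
                                 (CommutativeRing.0# F))
  where
  private
    module F = CommutativeRing F
    module K = CommutativeRing K
    module FF = RingFacts F
    module KF = RingFacts K
  open IsAlgebraicClosure closure using (isField; ι-hom; algClosed)
  open RingMorphisms.IsRingHomomorphism ι-hom using (⟦⟧-cong)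
  open Homomorphism F K ι ι-hom using (ι-affPow; ι-nonzero; ι-char2)
  open KF using (_^_; affPow; affPow-cong; affPow-∘; pow≡^)
  open KF.Char2 (ι-char2 char2) using (frobenius; prescribe-iterate)
  open KF.Field isField using (^-nonzero)
  open Exponents using (even-exponent; 2^k*2^k≡4^k)
  open import Data.Unit.Polymorphic using (tt)
  open import Relation.Binary.Reasoning.Setoid K.setoid

  iter-θ₄ : ∀ c d j y → iter (θ₄ K c d) j (just y) ≡ just (iter (affPow c d 4) j y)
  iter-θ₄ c d zero    y = P.refl
  iter-θ₄ c d (suc j) y rewrite iter-θ₄ c d j y = P.cong (λ z → just (c K.* z K.+ d)) (pow≡^ _ 4)

  iter-θ₄-∞ : ∀ c d j → iter (θ₄ K c d) j nothing ≡ nothing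
  iter-θ₄-∞ c d zero    = P.refl
  iter-θ₄-∞ c d (suc j) rewrite iter-θ₄-∞ c d j = P.refl

  ≈P-just : ∀ {p y z} → p ≡ just y → y K.≈ z → _≈P_ K p (just z)
  ≈P-just P.refl y≈z = y≈z

  ≈P-∞ : ∀ {p} → p ≡ nothing → _≈P_ K p nothing
  ≈P-∞ P.refl = tt

  ι-θ : ∀ a b k x → ι (a F.* pow F x (2 ^ℕ k) F.+ b) K.≈ affPow (ι a) (ι b) (2 ^ℕ k) (ι x)
  ι-θ a b k x = K.trans (⟦⟧-cong (F.reflexive (P.cong (λ z → a F.* z F.+ b) (FF.pow≡^ x (2 ^ℕ k)))))
                        (ι-affPow a b (2 ^ℕ k) x)

  ι≉0 : ∀ {a} → ¬ (a F.≈ F.0#) → ¬ (ι a K.≈ K.0#)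
  ι≉0 = ι-nonzero isFieldF (proj₁ isField)

  quartic-iterate : ∀ j A B → ¬ (A K.≈ K.0#) →
    ∃ λ c → ∃ λ d → ∀ y → iter (affPow c d 4) (suc j) y K.≈ affPow A B (4 ^ℕ suc j) y
  quartic-iterate = prescribe-iterate isField algClosed (frobenius 2) (s≤s (s≤s z≤n))

  even-iterate : ∀ k → 2 ≤ k → k % 2 ≡ 0 → ∀ a b → ¬ (a F.≈ F.0#) → ∃ λ c → ∃ λ d → ∀ x →
    _≈P_ K (iter (θ₄ K c d) (k / 2) (liftP1 ι x)) (liftP1 ι (θ F a b k x))
  even-iterate k 2≤k k%2≡0 a b a≉0 with even-exponent k 2≤k k%2≡0
  ... | j , k/2≡j+1 , 2^k≡4^j+1 = c , d , agree
    where
    construction : ∃ λ c → ∃ λ d → ∀ y → iter (affPow c d 4) (suc j) y K.≈ affPow (ι a) (ι b) (4 ^ℕ suc j) y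
    construction = quartic-iterate j (ι a) (ι b) (ι≉0 a≉0)
    c d : K.Carrier
    c = proj₁ construction
    d = proj₁ (proj₂ construction)
    iterate≈ : ∀ y → iter (affPow c d 4) (suc j) y K.≈ affPow (ι a) (ι b) (4 ^ℕ suc j) y
    iterate≈ = proj₂ (proj₂ construction)
    agree : ∀ x → _≈P_ K (iter (θ₄ K c d) (k / 2) (liftP1 ι x)) (liftP1 ι (θ F a b k x))
    agree nothing  = ≈P-∞ (iter-θ₄-∞ c d (k / 2))
    agree (just x) = ≈P-just (iter-θ₄ c d (k / 2) (ι x)) (begin
      iter (affPow c d 4) (k / 2) (ι x)            ≡⟨ P.cong (λ m → iter (affPow c d 4) m (ι x)) k/2≡j+1 ⟩
      iter (affPow c d 4) (suc j) (ι x)            ≈⟨ iterate≈ (ι x) ⟩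
      affPow (ι a) (ι b) (4 ^ℕ suc j) (ι x)        ≡⟨ P.cong (λ m → affPow (ι a) (ι b) m (ι x)) 2^k≡4^j+1 ⟨
      affPow (ι a) (ι b) (2 ^ℕ k) (ι x)            ≈⟨ ι-θ a b k x ⟨
      ι (a F.* pow F x (2 ^ℕ k) F.+ b)             ∎)

  odd-iterate : ∀ k → 2 ≤ k → ∀ a b → ¬ (a F.≈ F.0#) → ∃ λ c → ∃ λ d → ∀ x →
    _≈P_ K (iter (θ₄ K c d) k (liftP1 ι x)) (liftP1 ι (iter (θ F a b k) 2 x))
  odd-iterate (suc j) _ a b a≉0 = c , d , agree
    where
    Q : ℕ
    Q = 2 ^ℕ suc j
    -- θ_{ι a, ι b, k}² = y ↦ A·y^(Q·Q) + B.
    A B : K.Carrier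
    A = ι a K.* ι a ^ Q
    B = ι a K.* ι b ^ Q K.+ ι b
    construction : ∃ λ c → ∃ λ d → ∀ y → iter (affPow c d 4) (suc j) y K.≈ affPow A B (4 ^ℕ suc j) y
    construction = quartic-iterate j A B (^-nonzero (suc Q) (ι≉0 a≉0))
    c d : K.Carrier
    c = proj₁ construction
    d = proj₁ (proj₂ construction)
    iterate≈ : ∀ y → iter (affPow c d 4) (suc j) y K.≈ affPow A B (4 ^ℕ suc j) y
    iterate≈ = proj₂ (proj₂ construction)
    agree : ∀ x → _≈P_ K (iter (θ₄ K c d) (suc j) (liftP1 ι x)) (liftP1 ι (iter (θ F a b (suc j)) 2 x))
    agree nothing  = ≈P-∞ (iter-θ₄-∞ c d (suc j))
    agree (just x) = ≈P-just (iter-θ₄ c d (suc j) (ι x)) (begin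
      iter (affPow c d 4) (suc j) (ι x)                  ≈⟨ iterate≈ (ι x) ⟩
      affPow A B (4 ^ℕ suc j) (ι x)                      ≡⟨ P.cong (λ m → affPow A B m (ι x)) (2^k*2^k≡4^k (suc j)) ⟨
      affPow A B (Q *ℕ Q) (ι x)                          ≈⟨ affPow-∘ (frobenius (suc j)) (ι a) (ι b) (ι a) (ι b) Q (ι x) ⟨
      affPow (ι a) (ι b) Q (affPow (ι a) (ι b) Q (ι x))  ≈⟨ affPow-cong Q K.refl K.refl (ι-θ a b (suc j) x) ⟨
      affPow (ι a) (ι b) Q (ι (a F.* pow F x Q F.+ b))   ≈⟨ ι-θ a b (suc j) _ ⟨
      ι (a F.* pow F (a F.* pow F x Q F.+ b) Q F.+ b)    ∎)

  Conclusion : ℕ → F.Carrier → F.Carrier → K.Carrier → K.Carrier → Set (c₁ ⊔ ℓ₂)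
  Conclusion k a b c d = ∀ (x : P1 F) →
    (k % 2 ≡ 0 → _≈P_ K (iter (θ₄ K c d) (k / 2) (liftP1 ι x)) (liftP1 ι (θ F a b k x))) ×
    (k % 2 ≡ 1 → _≈P_ K (iter (θ₄ K c d) k (liftP1 ι x)) (liftP1 ι (iter (θ F a b k) 2 x)))

  conclusion : ∀ k → 2 ≤ k → ∀ a b → ¬ (a F.≈ F.0#) → Dec (k % 2 ≡ 0) →
               ∃ λ c → ∃ λ d → Conclusion k a b c d
  conclusion k 2≤k a b a≉0 (yes even) with even-iterate k 2≤k even a b a≉0
  ... | c , d , agree = c , d , λ x → (λ _ → agree x) , (λ odd → ⊥-elim (0≢1 (P.trans (P.sym even) odd)))
    where
    0≢1 : ¬ (0 ≡ 1)
    0≢1 ()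
  conclusion k 2≤k a b a≉0 (no ¬even) with odd-iterate k 2≤k a b a≉0
  ... | c , d , agree = c , d , λ x → (λ even → ⊥-elim (¬even even)) , (λ _ → agree x)

lemma4p2 : ∀ {c₁ ℓ₁ c₂ ℓ₂ : Level} (n : ℕ) → n ≥ 1 →
  (F : CommutativeRing c₁ ℓ₁) → IsField F → HasCardinality F (2 ^ℕ n) →
  (K : CommutativeRing c₂ ℓ₂) (ι : CommutativeRing.Carrier F → CommutativeRing.Carrier K) →
  IsAlgebraicClosure F K ι →
  (k : ℕ) → k ≥ 2 →
  (a b : CommutativeRing.Carrier F) → ¬ (CommutativeRing._≈_ F a (CommutativeRing.0# F)) →
  ∃ λ (c : CommutativeRing.Carrier K) → ∃ λ (d : CommutativeRing.Carrier K) →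
    ∀ (x : P1 F) →
      (k % 2 ≡ 0 → _≈P_ K (iter (θ₄ K c d) (k / 2) (liftP1 ι x)) (liftP1 ι (θ F a b k x))) ×
      (k % 2 ≡ 1 → _≈P_ K (iter (θ₄ K c d) k (liftP1 ι x)) (liftP1 ι (iter (θ F a b k) 2 x)))
lemma4p2 n n≥1 F isF card K ι closure k 2≤k a b a≉0 = conclusion k 2≤k a b a≉0 (k % 2 ≟ 0)
  where
  open import Data.Nat using (_≟_)
  char2 : CommutativeRing._≈_ F (CommutativeRing._+_ F (CommutativeRing.1# F) (CommutativeRing.1# F)) (CommutativeRing.0# F)
  char2 = EvenCardinality.even⇒char2 F isF card (Exponents.2∣2^n n≥1)
  open Construction F K ι closure isF char2 using (conclusion)
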